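{- Let $k>0$ and $\alpha=(\alpha_1,\dots,\alpha_r)\in[k]^r$ with $\alpha_1+\cdots+\alpha_r=n$. Identify monomials $x_1^{a_1}\cdots x_n^{a_n}$ with their exponent sequences $(a_1,\dots,a_n)\in\mathbb{Z}_{\ge0}^n$. Then the set $\mathcal{M}_{\alpha,k}$ of $\alpha$-nonskip monomials is stable under the restriction to the parabolic subgroup $\mathfrak{S}_\alpha$ of the action of $\mathfrak{S}_n$ on $\mathbb{Z}_{\ge0}^n$ described below.
   Context: The action of $\mathfrak{S}_n$ on $\mathbb{Z}_{\ge0}^n$: the adjacent transposition $s_i=(i,i+1)$ sends $(a_1,\dots,a_n)$ to the sequence obtained by replacing $(a_i,a_{i+1})$ with $(a_{i+1},a_i-1)$ if $a_i>a_{i+1}$ and with $(a_{i+1}+1,a_i)$ if $a_i\le a_{i+1}$, leaving other entries unchanged; this rule extends to a (free) action of $\mathfrak{S}_n$. $\mathfrak{S}_\alpha=\mathfrak{S}_{\alpha_1}\times\cdots\times\mathfrak{S}_{\alpha_r}$ is the subgroup generated by the $s_p$ with $p\in[n-1]\setminus\{\alpha_1,\alpha_1+\alpha_2,\dots\}$. For $S=\{s_1<\cdots<s_t\}\subseteq[n]$ the skip sequence $\gamma(S)=(\gamma_1,\dots,\gamma_n)$ has $\gamma_i=i-j+1$ if $i=s_j$ and $\gamma_i=0$ if $i\notin S$; the reverse skip monomial is $\mathbf{x}(S)^*=x_1^{\gamma_n}\cdots x_n^{\gamma_1}$. A monomial $m$ is $\alpha$-nonskip if $\mathbf{x}(S)^*\nmid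 m$ for every $S\subseteq[n]$ with $|S|=n-k+1$, and $x_{\alpha_1+\cdots+\alpha_{i-1}+j}^{k-j+1}\nmid m$ for all $1\le i\le r$, $1\le j\le\alpha_i$; $\mathcal{M}_{\alpha,k}$ is the set of such monomials in $\mathbb{Q}[x_1,\dots,x_n]$. -}

module Defs where

open import Data.Nat using (ℕ; zero; suc; _+_; _∸_; _≤_; _<_; _≟_)
open import Data.Nat.Properties using (_<?_)
open import Data.Bool using (true; false; if_then_else_)
open import Data.Fin using (Fin; toℕ)
open import Data.Fin.Subset using (Subset; ∣_∣)
open import Data.Vec using (Vec; []; _∷_; reverse; tabulate; lookup; toList)
open import Data.Vec.Relation.Binary.Pointwise.Inductive using (Pointwise)
open import Data.Vec.Relation.Unary.All using (All)
open import Data.List using (List; foldr; take)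
open import Data.Nat.ListAction using (sum)
import Data.List.Relation.Unary.All as L
open import Data.Product using (_×_)
open import Relation.Nullary using (¬_; does)
open import Relation.Binary.PropositionalEquality using (_≡_; _≢_)

Monomial : ℕ → Set
Monomial n = Vec ℕ n

_∣ₘ_ : ∀ {n} → Monomial n → Monomial n → Set
e ∣ₘ a = Pointwise _≤_ e a

-- The monomial x_p^e (p is 1-indexed).
xPow : (n p e : ℕ) → Monomial n
xPow n p e = tabulate (λ t → if does (suc (toℕ t) ≟ p) then e else 0)

-- Skip sequence γ(S).  Auxiliary: i = current (1-indexed) position,
-- c = number of elements of S strictly before position i.  If i = s_j then
-- j = c + 1 and γᵢ = i - j + 1 = i - c.
skipAux : ∀ {n} → ℕ → ℕ → Subset n → Vec ℕ n
skipAux i c [] = []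
skipAux i c (true ∷ s) = (i ∸ c) ∷ skipAux (suc i) (suc c) s
skipAux i c (false ∷ s) = 0 ∷ skipAux (suc i) c s

skipSeq : ∀ {n} → Subset n → Vec ℕ n
skipSeq S = skipAux 1 0 S

revSkipMono : ∀ {n} → Subset n → Monomial n
revSkipMono S = reverse (skipSeq S)

psum : ∀ {r} → Vec ℕ r → ℕ → ℕ
psum α m = sum (take m (toList α))

-- α-nonskip monomials (membership in 𝓜_{α,k}).
-- |S| = n - k + 1 is written |S| + k = n + 1 (no such S when k > n + 1).
NonSkip : ∀ {n r} → Vec ℕ r → ℕ → Monomial n → Set
NonSkip {n} {r} α k m =
  ((S : Subset n) → ∣ S ∣ + k ≡ n + 1 → ¬ (revSkipMono S ∣ₘ m))
  × ((i : Fin r) (j : ℕ) → 1 ≤ j → j ≤ lookup α i →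
       ¬ (xPow n (psum α (toℕ i) + j) (k ∸ j + 1) ∣ₘ m))

-- Action of the adjacent transposition s_p (p 1-indexed) on ℤ_{≥0}^n.
sAct : ∀ {n} → ℕ → Vec ℕ n → Vec ℕ n
sAct (suc zero) (a ∷ b ∷ xs) =
  if does (b <? a) then b ∷ (a ∸ 1) ∷ xs else suc b ∷ a ∷ xs
sAct (suc (suc p)) (a ∷ xs) = a ∷ sAct (suc p) xs
sAct _ xs = xs

-- Action of a word s_{p₁} ⋯ s_{p_m} (rightmost acts first).
wordAct : ∀ {n} → List ℕ → Vec ℕ n → Vec ℕ n
wordAct w a = foldr sAct a w

ParabolicGen : ∀ {r} → ℕ → Vec ℕ r → ℕ → Set
ParabolicGen {r} n α p = 1 ≤ p × p < n × ((i : Fin r) → p ≢ psum α (suc (toℕ i)))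

ParabolicWord : ∀ {r} → ℕ → Vec ℕ r → List ℕ → Set
ParabolicWord n α w = L.All (ParabolicGen n α) w

module Submission where

-- It suffices to treat one generator s_p of 𝔖_α, since a word acts letter by
-- letter; membership in 𝓜_{α,k} consists of two independent conditions.
--
-- (1) No reverse skip monomial x(S)* with |S| = n-k+1 divides m.  Reading S
--     backwards, x(S)* = E(T) for T = reverse S, where E(T) (revSkip 0 T) has exponent
--     1 + #{non-elements of T to the right} at each element of T and 0 elsewhere.
--     An exchange argument on the two coordinates touched by s_p shows: if
--     E(T) ∣ s_p m then E(T') ∣ m for some T' with |T'| = |T|.  This holds for
--     every adjacent transposition, parabolic or not.
-- (2) The block conditions x_{P+j}^{k-j+1} ∤ m (P the start offset of a block,
--     1 ≤ j ≤ α_i) are bounds  m_{P+j} ≤ k - j  on single coordinates.  Since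
--     p and p+1 lie in one block of α, the bounds at columns j, j+1 of m bound
--     the two coordinates of s_p m changed by s_p.

open import Defs
open import Data.Nat
open import Data.Nat.Properties
open import Data.Bool using (true; false; if_then_else_)
open import Data.Bool.Properties using () renaming (_≟_ to _≟ᵇ_)
open import Data.Fin using (Fin; zero; suc; toℕ; inject₁)
open import Data.Fin.Properties using (toℕ-inject₁)
open import Data.Fin.Subset using (Subset; ∣_∣; inside; outside)
open import Data.Vec using (Vec; []; _∷_; tabulate; lookup; reverse; _∷ʳ_; count)
open import Data.Vec.Properties using (reverse-∷; reverse-involutive)
open import Data.Vec.Relation.Binary.Pointwise.Inductive using ([]; _∷_)
open import Data.Vec.Relation.Unary.All using (All)
open import Data.Vec.Relation.Unary.All.Properties using (lookup⁺)
open import Data.List using (List; []; _∷_)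
import Data.List.Relation.Unary.All as ListAll
open import Data.Product using (Σ; _×_; _,_; proj₂)
open import Data.Empty using (⊥-elim)
open import Function using (id; _∘_)
open import Relation.Nullary using (¬_; does; yes; no)
open import Relation.Nullary.Reflects using (ofʸ; ofⁿ)
open import Relation.Unary using (Pred; Decidable)
open import Relation.Binary.PropositionalEquality

-- The exponent of x_q in a monomial (q is 1-indexed; 0 when q is out of range).
coeff : ∀ {n} → Monomial n → ℕ → ℕ
coeff [] _ = 0
coeff (x ∷ xs) zero = 0
coeff (x ∷ xs) (suc zero) = x
coeff (x ∷ xs) (suc (suc q)) = coeff xs (suc q)

one∣ₘ : ∀ {n} (v : Monomial n) → tabulate {n = n} (λ _ → 0) ∣ₘ v
one∣ₘ [] = []
one∣ₘ (x ∷ v) = z≤n ∷ one∣ₘ v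

coeff⇒xPow∣ₘ : ∀ {n} (v : Monomial n) q e → e ≤ coeff v q → xPow n q e ∣ₘ v
coeff⇒xPow∣ₘ [] q e _ = []
coeff⇒xPow∣ₘ (x ∷ v) zero e _ = z≤n ∷ one∣ₘ v
coeff⇒xPow∣ₘ (x ∷ v) (suc zero) e e≤x = e≤x ∷ one∣ₘ v
coeff⇒xPow∣ₘ (x ∷ v) (suc (suc q)) e e≤v = z≤n ∷ coeff⇒xPow∣ₘ v (suc q) e e≤v

xPow∣ₘ⇒coeff : ∀ {n} (v : Monomial n) q e → 1 ≤ q → q ≤ n → xPow n q e ∣ₘ v → e ≤ coeff v q
xPow∣ₘ⇒coeff (x ∷ v) (suc zero) e _ _ (e≤x ∷ _) = e≤x
xPow∣ₘ⇒coeff (x ∷ v) (suc (suc q)) e _ (s≤s q<n) (_ ∷ d) = xPow∣ₘ⇒coeff v (suc q) e (s≤s z≤n) q<n d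

xPow∣ₘ-mono : ∀ {n} (v w : Monomial n) q e → coeff v q ≤ coeff w q → xPow n q e ∣ₘ v → xPow n q e ∣ₘ w
xPow∣ₘ-mono [] [] q e _ _ = []
xPow∣ₘ-mono (x ∷ v) (y ∷ w) zero e _ _ = z≤n ∷ one∣ₘ w
xPow∣ₘ-mono (x ∷ v) (y ∷ w) (suc zero) e x≤y (e≤x ∷ _) = ≤-trans e≤x x≤y ∷ one∣ₘ w
xPow∣ₘ-mono (x ∷ v) (y ∷ w) (suc (suc q)) e v≤w (_ ∷ d) = z≤n ∷ xPow∣ₘ-mono v w (suc q) e v≤w d

¬xPow∣ₘ⇒coeff≤ : ∀ {n} (v : Monomial n) q c → ¬ (xPow n q (c + 1) ∣ₘ v) → coeff v q ≤ c
¬xPow∣ₘ⇒coeff≤ v q c ∤ = m<n+1⇒m≤n (≰⇒> (λ c+1≤ → ∤ (coeff⇒xPow∣ₘ v q (c + 1) c+1≤)))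
  where
  m<n+1⇒m≤n : ∀ {a b} → a < b + 1 → a ≤ b
  m<n+1⇒m≤n {a} {b} a<b+1 = m<1+n⇒m≤n (subst (a <_) (+-comm b 1) a<b+1)

coeff≤⇒¬xPow∣ₘ : ∀ {n} (v : Monomial n) q c → 1 ≤ q → q ≤ n → coeff v q ≤ c → ¬ (xPow n q (c + 1) ∣ₘ v)
coeff≤⇒¬xPow∣ₘ v q c 1≤q q≤n ≤c d =
  <⇒≱ (subst (coeff v q <_) (+-comm 1 c) (s≤s ≤c)) (xPow∣ₘ⇒coeff v q (c + 1) 1≤q q≤n d)

coeff-head₂ : ∀ {n} q (x y a b : ℕ) (xs : Monomial n) → q ≢ 1 → q ≢ 2 →
  coeff (x ∷ y ∷ xs) q ≡ coeff (a ∷ b ∷ xs) q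
coeff-head₂ zero x y a b xs _ _ = refl
coeff-head₂ (suc zero) x y a b xs q≢1 _ = ⊥-elim (q≢1 refl)
coeff-head₂ (suc (suc zero)) x y a b xs _ q≢2 = ⊥-elim (q≢2 refl)
coeff-head₂ (suc (suc (suc q))) x y a b xs _ _ = refl

coeff-sAct-other : ∀ {n} p q (m : Monomial n) → q ≢ p → q ≢ suc p → coeff (sAct p m) q ≡ coeff m q
coeff-sAct-other zero q m _ _ = refl
coeff-sAct-other (suc zero) q [] _ _ = refl
coeff-sAct-other (suc zero) q (a ∷ []) _ _ = refl
coeff-sAct-other (suc zero) q (a ∷ b ∷ xs) q≢1 q≢2 with b <ᵇ a
... | true = coeff-head₂ q b (a ∸ 1) a b xs q≢1 q≢2
... | false = coeff-head₂ q (suc b) a a b xs q≢1 q≢2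
coeff-sAct-other (suc (suc p)) q [] _ _ = refl
coeff-sAct-other (suc (suc p)) zero (a ∷ xs) _ _ = refl
coeff-sAct-other (suc (suc p)) (suc zero) (a ∷ xs) _ _ = refl
coeff-sAct-other (suc (suc p)) (suc (suc q)) (a ∷ xs) q≢p q≢p+1 =
  coeff-sAct-other (suc p) (suc q) xs (q≢p ∘ cong suc) (q≢p+1 ∘ cong suc)

-- The new coordinate p is (m_{p+1} or m_{p+1} + 1), so it exceeds m_{p+1} by at most one.
coeff-sAct-left : ∀ {n} p (m : Monomial n) {c} → suc (suc p) ≤ n →
  coeff m (suc (suc p)) ≤ c → coeff (sAct (suc p) m) (suc p) ≤ suc c
coeff-sAct-left zero (a ∷ b ∷ xs) _ b≤c with b <ᵇ a
... | true = m≤n⇒m≤1+n b≤c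
... | false = s≤s b≤c
coeff-sAct-left zero (a ∷ []) (s≤s ()) _
coeff-sAct-left (suc p) (a ∷ xs) (s≤s p<n) b≤c = coeff-sAct-left p xs p<n b≤c

-- The new coordinate p+1 is (m_p - 1 when m_{p+1} < m_p, else m_p ≤ m_{p+1}),
-- so it obeys the bound c whenever m_p ≤ c + 1 and m_{p+1} ≤ c.
coeff-sAct-right : ∀ {n} p (m : Monomial n) {c} → suc (suc p) ≤ n →
  coeff m (suc p) ≤ suc c → coeff m (suc (suc p)) ≤ c → coeff (sAct (suc p) m) (suc (suc p)) ≤ c
coeff-sAct-right zero (a ∷ b ∷ xs) _ a≤c+1 b≤c with b <ᵇ a | <ᵇ-reflects-< b a
... | true | ofʸ _ = ∸-monoˡ-≤ 1 a≤c+1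
... | false | ofⁿ b≮a = ≤-trans (≮⇒≥ b≮a) b≤c
coeff-sAct-right zero (a ∷ []) (s≤s ()) _ _
coeff-sAct-right (suc p) (a ∷ xs) (s≤s p<n) a≤c+1 b≤c = coeff-sAct-right p xs p<n a≤c+1 b≤c

BlockCondition : ∀ {n r} → Vec ℕ r → ℕ → Monomial n → Set
BlockCondition {n} {r} α k m =
  (i : Fin r) (j : ℕ) → 1 ≤ j → j ≤ lookup α i → ¬ (xPow n (psum α (toℕ i) + j) (k ∸ j + 1) ∣ₘ m)

blockBound : ∀ {n r} (α : Vec ℕ r) k (m : Monomial n) → BlockCondition α k m →
  (i : Fin r) (j : ℕ) → 1 ≤ j → j ≤ lookup α i → coeff m (psum α (toℕ i) + j) ≤ k ∸ j
blockBound α k m H i j 1≤j j≤α = ¬xPow∣ₘ⇒coeff≤ m _ (k ∸ j) (H i j 1≤j j≤α)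

psum-suc : ∀ {r} (α : Vec ℕ r) (i : Fin r) → psum α (suc (toℕ i)) ≡ psum α (toℕ i) + lookup α i
psum-suc (x ∷ α) zero = +-identityʳ x
psum-suc (x ∷ α) (suc i) = trans (cong (x +_) (psum-suc α i)) (sym (+-assoc x _ _))

notLastColumn : ∀ {r} (α : Vec ℕ r) p (i : Fin r) j → ((i : Fin r) → p ≢ psum α (suc (toℕ i))) →
  psum α (toℕ i) + j ≡ p → j ≤ lookup α i → j < lookup α i
notLastColumn α p i j notEnd P+j≡p j≤α = ≤∧≢⇒< j≤α λ j≡α →
  notEnd i (trans (sym P+j≡p) (trans (cong (psum α (toℕ i) +_) j≡α) (sym (psum-suc α i))))

notBlockStart : ∀ {r} (α : Vec ℕ r) p (i : Fin r) → ((i : Fin r) → suc p ≢ psum α (suc (toℕ i))) →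
  psum α (toℕ i) ≢ suc p
notBlockStart α p zero notEnd ()
notBlockStart α p (suc i) notEnd P≡p =
  notEnd (inject₁ i) (sym (trans (cong (λ t → psum α (suc t)) (toℕ-inject₁ i)) P≡p))

sAct-left-avoids : ∀ {n} p (m : Monomial n) k j → suc (suc p) ≤ n → j < k →
  coeff m (suc (suc p)) ≤ k ∸ suc j → ¬ (xPow n (suc p) (k ∸ j + 1) ∣ₘ sAct (suc p) m)
sAct-left-avoids p m k j p<n j<k m₊≤ =
  coeff≤⇒¬xPow∣ₘ (sAct (suc p) m) (suc p) (k ∸ j) (s≤s z≤n) (<⇒≤ p<n)
    (subst (coeff (sAct (suc p) m) (suc p) ≤_) (sym (+-∸-assoc 1 j<k)) (coeff-sAct-left p m p<n m₊≤))

sAct-right-avoids : ∀ {n} p (m : Monomial n) k j → suc (suc p) ≤ n → suc j < k →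
  coeff m (suc p) ≤ k ∸ suc j → coeff m (suc (suc p)) ≤ k ∸ suc (suc j) →
  ¬ (xPow n (suc (suc p)) (k ∸ suc (suc j) + 1) ∣ₘ sAct (suc p) m)
sAct-right-avoids p m k j p<n j+1<k m≤ m₊≤ =
  coeff≤⇒¬xPow∣ₘ (sAct (suc p) m) (suc (suc p)) (k ∸ suc (suc j)) (s≤s z≤n) p<n
    (coeff-sAct-right p m p<n (subst (coeff m (suc p) ≤_) (+-∸-assoc 1 j+1<k) m≤) m₊≤)

-- The column entries at p and p+1 are controlled by the neighbouring columns of
-- the same block; all other entries are unchanged.
blockCondition-sAct : ∀ {n r} k (α : Vec ℕ r) → All (λ a → 1 ≤ a × a ≤ k) α → ∀ p →
  ParabolicGen n α p → (m : Monomial n) → BlockCondition α k m → BlockCondition α k (sAct p m)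
blockCondition-sAct k α αk zero (() , _)
blockCondition-sAct {n} k α αk (suc p) (_ , p<n , notEnd) m H i j 1≤j j≤α
  with psum α (toℕ i) + j ≟ suc p | psum α (toℕ i) + j ≟ suc (suc p)
... | yes P+j≡p | _ =
  subst (λ q → ¬ (xPow n q (k ∸ j + 1) ∣ₘ sAct (suc p) m)) (sym P+j≡p)
    (sAct-left-avoids p m k j p<n (<-≤-trans j<α (proj₂ (lookup⁺ αk i))) m₊≤)
  where
  j<α : j < lookup α i
  j<α = notLastColumn α (suc p) i j notEnd P+j≡p j≤α
  m₊≤ : coeff m (suc (suc p)) ≤ k ∸ suc j
  m₊≤ = subst (λ q → coeff m q ≤ k ∸ suc j) (trans (+-suc _ j) (cong suc P+j≡p))
          (blockBound α k m H i (suc j) (s≤s z≤n) j<α)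
... | no _ | yes P+j≡p+1 = rightColumn j 1≤j j≤α P+j≡p+1
  where
  P = psum α (toℕ i)
  rightColumn : ∀ j → 1 ≤ j → j ≤ lookup α i → P + j ≡ suc (suc p) →
    ¬ (xPow n (P + j) (k ∸ j + 1) ∣ₘ sAct (suc p) m)
  rightColumn (suc zero) _ _ P+1≡p+1 =
    ⊥-elim (notBlockStart α p i notEnd (suc-injective (trans (+-comm 1 P) P+1≡p+1)))
  rightColumn (suc (suc j)) _ j+2≤α P+j+2≡p+1 =
    subst (λ q → ¬ (xPow n q (k ∸ suc (suc j) + 1) ∣ₘ sAct (suc p) m)) (sym P+j+2≡p+1)
      (sAct-right-avoids p m k j p<n (≤-trans j+2≤α (proj₂ (lookup⁺ αk i))) m≤ m₊≤)
    where
    m≤ : coeff m (suc p) ≤ k ∸ suc j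
    m≤ = subst (λ q → coeff m q ≤ k ∸ suc j) (suc-injective (trans (sym (+-suc P (suc j))) P+j+2≡p+1))
           (blockBound α k m H i (suc j) (s≤s z≤n) (≤-trans (n≤1+n _) j+2≤α))
    m₊≤ : coeff m (suc (suc p)) ≤ k ∸ suc (suc j)
    m₊≤ = subst (λ q → coeff m q ≤ k ∸ suc (suc j)) P+j+2≡p+1
            (blockBound α k m H i (suc (suc j)) (s≤s z≤n) j+2≤α)
... | no P+j≢p | no P+j≢p+1 =
  H i j 1≤j j≤α ∘ xPow∣ₘ-mono (sAct (suc p) m) m _ _
    (≤-reflexive (coeff-sAct-other (suc p) _ m P+j≢p P+j≢p+1))

module _ {a p} {A : Set a} {P : Pred A p} (P? : Decidable P) where

  count-∷ʳ : ∀ {n} x (xs : Vec A n) → count P? (xs ∷ʳ x) ≡ count P? (x ∷ xs)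
  count-∷ʳ x [] = refl
  count-∷ʳ x (y ∷ xs) rewrite count-∷ʳ x xs with does (P? x) | does (P? y)
  ... | true | true = refl
  ... | true | false = refl
  ... | false | true = refl
  ... | false | false = refl

  count-reverse : ∀ {n} (xs : Vec A n) → count P? (reverse xs) ≡ count P? xs
  count-reverse [] = refl
  count-reverse (x ∷ xs) = begin
    count P? (reverse (x ∷ xs))  ≡⟨ cong (count P?) (reverse-∷ x xs) ⟩
    count P? (reverse xs ∷ʳ x)   ≡⟨ count-∷ʳ x (reverse xs) ⟩
    count P? (x ∷ reverse xs)    ≡⟨ cong (if does (P? x) then suc else id) (count-reverse xs) ⟩
    count P? (x ∷ xs)            ∎
    where open ≡-Reasoning

∣_∣ᶜ : ∀ {n} → Subset n → ℕ
∣ T ∣ᶜ = count (_≟ᵇ outside) T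

-- Skip sequence with offset f, read forwards: an element of S gets
-- 1 + f + #(non-elements before it), since γ_{s_j} = s_j - j + 1.
skipFrom : ∀ {n} → ℕ → Subset n → Vec ℕ n
skipFrom f [] = []
skipFrom f (true ∷ S) = suc f ∷ skipFrom f S
skipFrom f (false ∷ S) = 0 ∷ skipFrom (suc f) S

-- At position i with c elements before it there are f = i - 1 - c non-elements before it.
skipAux≡skipFrom : ∀ {n} i c f (S : Subset n) → i ≡ suc (f + c) → skipAux i c S ≡ skipFrom f S
skipAux≡skipFrom i c f [] _ = refl
skipAux≡skipFrom i c f (true ∷ S) refl =
  cong₂ _∷_ (m+n∸n≡m (suc f) c) (skipAux≡skipFrom _ (suc c) f S (cong suc (sym (+-suc f c))))
skipAux≡skipFrom i c f (false ∷ S) refl = cong (0 ∷_) (skipAux≡skipFrom _ c (suc f) S refl)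

-- The same sequence read backwards: an element of T gets 1 + f + #(non-elements after it).
revSkip : ∀ {n} → ℕ → Subset n → Vec ℕ n
revSkip f [] = []
revSkip f (true ∷ T) = suc (f + ∣ T ∣ᶜ) ∷ revSkip f T
revSkip f (false ∷ T) = 0 ∷ revSkip f T

revSkip-∷ʳ-inside : ∀ {n} f (T : Subset n) → revSkip f (T ∷ʳ inside) ≡ revSkip f T ∷ʳ suc f
revSkip-∷ʳ-inside f [] = cong (λ e → suc e ∷ []) (+-identityʳ f)
revSkip-∷ʳ-inside f (true ∷ T) =
  cong₂ _∷_ (cong (λ c → suc (f + c)) (count-∷ʳ (_≟ᵇ outside) inside T)) (revSkip-∷ʳ-inside f T)
revSkip-∷ʳ-inside f (false ∷ T) = cong (0 ∷_) (revSkip-∷ʳ-inside f T)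

revSkip-∷ʳ-outside : ∀ {n} f (T : Subset n) → revSkip f (T ∷ʳ outside) ≡ revSkip (suc f) T ∷ʳ 0
revSkip-∷ʳ-outside f [] = refl
revSkip-∷ʳ-outside f (true ∷ T) =
  cong₂ _∷_ (cong suc (trans (cong (f +_) (count-∷ʳ (_≟ᵇ outside) outside T)) (+-suc f ∣ T ∣ᶜ)))
            (revSkip-∷ʳ-outside f T)
revSkip-∷ʳ-outside f (false ∷ T) = cong (0 ∷_) (revSkip-∷ʳ-outside f T)

reverse-skipFrom : ∀ {n} f (S : Subset n) → reverse (skipFrom f S) ≡ revSkip f (reverse S)
reverse-skipFrom f [] = refl
reverse-skipFrom f (true ∷ S) = begin
  reverse (suc f ∷ skipFrom f S)    ≡⟨ reverse-∷ (suc f) (skipFrom f S) ⟩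
  reverse (skipFrom f S) ∷ʳ suc f   ≡⟨ cong (_∷ʳ suc f) (reverse-skipFrom f S) ⟩
  revSkip f (reverse S) ∷ʳ suc f    ≡⟨ revSkip-∷ʳ-inside f (reverse S) ⟨
  revSkip f (reverse S ∷ʳ inside)   ≡⟨ cong (revSkip f) (reverse-∷ inside S) ⟨
  revSkip f (reverse (inside ∷ S))  ∎
  where open ≡-Reasoning
reverse-skipFrom f (false ∷ S) = begin
  reverse (0 ∷ skipFrom (suc f) S)    ≡⟨ reverse-∷ 0 (skipFrom (suc f) S) ⟩
  reverse (skipFrom (suc f) S) ∷ʳ 0   ≡⟨ cong (_∷ʳ 0) (reverse-skipFrom (suc f) S) ⟩
  revSkip (suc f) (reverse S) ∷ʳ 0    ≡⟨ revSkip-∷ʳ-outside f (reverse S) ⟨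
  revSkip f (reverse S ∷ʳ outside)    ≡⟨ cong (revSkip f) (reverse-∷ outside S) ⟨
  revSkip f (reverse (outside ∷ S))   ∎
  where open ≡-Reasoning

revSkipMono≡revSkip : ∀ {n} (S : Subset n) → revSkipMono S ≡ revSkip 0 (reverse S)
revSkipMono≡revSkip S = trans (cong reverse (skipAux≡skipFrom 1 0 0 S refl)) (reverse-skipFrom 0 S)

-- Only positions p and
-- p+1 matter; there, T' keeps or swaps the membership of the two positions.
revSkip-exchange : ∀ {n} p (T : Subset n) (m : Monomial n) → revSkip 0 T ∣ₘ sAct p m →
  Σ (Subset n) λ T' → ∣ T' ∣ ≡ ∣ T ∣ × ∣ T' ∣ᶜ ≡ ∣ T ∣ᶜ × revSkip 0 T' ∣ₘ m
revSkip-exchange zero T m d = T , refl , refl , d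
revSkip-exchange (suc zero) T [] d = T , refl , refl , d
revSkip-exchange (suc zero) T (a ∷ []) d = T , refl , refl , d
revSkip-exchange (suc zero) (x ∷ y ∷ T) (a ∷ b ∷ m) d with b <ᵇ a | <ᵇ-reflects-< b a
-- s₁ m = (b, a - 1, …) with b < a.
revSkip-exchange (suc zero) (true ∷ true ∷ T) (a ∷ b ∷ m) (e≤b ∷ e≤a-1 ∷ d) | true | ofʸ _ =
  (true ∷ true ∷ T) , refl , refl , (≤-trans e≤a-1 (m∸n≤m a 1) ∷ e≤b ∷ d)
revSkip-exchange (suc zero) (true ∷ false ∷ T) (a ∷ b ∷ m) (e+1≤b ∷ _ ∷ d) | true | ofʸ _ =
  (false ∷ true ∷ T) , refl , refl , (z≤n ∷ <⇒≤ e+1≤b ∷ d)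
revSkip-exchange (suc zero) (false ∷ true ∷ T) (a ∷ b ∷ m) (_ ∷ e≤a-1 ∷ d) | true | ofʸ _ =
  (true ∷ false ∷ T) , refl , refl , (e+1≤a e≤a-1 ∷ z≤n ∷ d)
  where
  e+1≤a : ∀ {e a} → suc e ≤ a ∸ 1 → suc (suc e) ≤ a
  e+1≤a {a = suc a} e≤a-1 = s≤s e≤a-1
revSkip-exchange (suc zero) (false ∷ false ∷ T) (a ∷ b ∷ m) (_ ∷ _ ∷ d) | true | ofʸ _ =
  (false ∷ false ∷ T) , refl , refl , (z≤n ∷ z≤n ∷ d)
-- s₁ m = (b + 1, a, …) with a ≤ b.
revSkip-exchange (suc zero) (true ∷ true ∷ T) (a ∷ b ∷ m) (_ ∷ e≤a ∷ d) | false | ofⁿ b≮a =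
  (true ∷ true ∷ T) , refl , refl , (e≤a ∷ ≤-trans e≤a (≮⇒≥ b≮a) ∷ d)
revSkip-exchange (suc zero) (true ∷ false ∷ T) (a ∷ b ∷ m) (s≤s e≤b ∷ _ ∷ d) | false | ofⁿ _ =
  (false ∷ true ∷ T) , refl , refl , (z≤n ∷ e≤b ∷ d)
revSkip-exchange (suc zero) (false ∷ true ∷ T) (a ∷ b ∷ m) (_ ∷ e≤a ∷ d) | false | ofⁿ b≮a =
  (false ∷ true ∷ T) , refl , refl , (z≤n ∷ ≤-trans e≤a (≮⇒≥ b≮a) ∷ d)
revSkip-exchange (suc zero) (false ∷ false ∷ T) (a ∷ b ∷ m) (_ ∷ _ ∷ d) | false | ofⁿ _ =
  (false ∷ false ∷ T) , refl , refl , (z≤n ∷ z≤n ∷ d)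
-- Away from the head, keep the head of T; its exponent only depends on ∣ T ∣ᶜ.
revSkip-exchange (suc (suc p)) T [] d = T , refl , refl , d
revSkip-exchange (suc (suc p)) (true ∷ T) (a ∷ m) (e≤a ∷ d) with revSkip-exchange (suc p) T m d
... | T' , sameIn , sameOut , d' =
  (true ∷ T') , cong suc sameIn , sameOut , (subst (λ c → suc c ≤ a) (sym sameOut) e≤a ∷ d')
revSkip-exchange (suc (suc p)) (false ∷ T) (a ∷ m) (_ ∷ d) with revSkip-exchange (suc p) T m d
... | T' , sameIn , sameOut , d' = (false ∷ T') , sameIn , cong suc sameOut , (z≤n ∷ d')

SkipFree : ∀ {n} → ℕ → Monomial n → Set
SkipFree {n} k m = (S : Subset n) → ∣ S ∣ + k ≡ n + 1 → ¬ (revSkipMono S ∣ₘ m)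

skipFree-sAct : ∀ {n} k p (m : Monomial n) → SkipFree k m → SkipFree k (sAct p m)
skipFree-sAct k p m free S size d
  with revSkip-exchange p (reverse S) m (subst (_∣ₘ sAct p m) (revSkipMono≡revSkip S) d)
... | T , sameIn , _ , d' = free (reverse T) size' (subst (_∣ₘ m) (sym revSkipMono-reverseT) d')
  where
  size' : ∣ reverse T ∣ + k ≡ _
  size' = trans (cong (_+ k) (trans (count-reverse (_≟ᵇ inside) T)
                                     (trans sameIn (count-reverse (_≟ᵇ inside) S)))) size
  revSkipMono-reverseT : revSkipMono (reverse T) ≡ revSkip 0 T
  revSkipMono-reverseT = trans (revSkipMono≡revSkip (reverse T)) (cong (revSkip 0) (reverse-involutive T))

-- Main theorem: 𝓜_{α,k} is stable under 𝔖_α, acting through words in its generators.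
-- Induction on the word.
lemma3p8 : (k n r : ℕ) → 0 < k → (α : Vec ℕ r) → All (λ a → 1 ≤ a × a ≤ k) α →
           Data.Vec.sum α ≡ n → (w : List ℕ) → ParabolicWord n α w →
           (m : Monomial n) → NonSkip α k m → NonSkip α k (wordAct w m)
lemma3p8 k n r _ α αk _ [] _ m nonSkip = nonSkip
lemma3p8 k n r k>0 α αk Σα≡n (p ∷ w) (gen ListAll.∷ gens) m nonSkip
  with lemma3p8 k n r k>0 α αk Σα≡n w gens m nonSkip
... | free , blocks =
  skipFree-sAct k p (wordAct w m) free , blockCondition-sAct k α αk p gen (wordAct w m) blocks
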